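{- Let $a,b,c,d$ be integers with $ac\neq 0$, $\gcd(a,b)=\gcd(c,d)=1$ and $\Delta:=ad-bc\neq 0$. Suppose $g$ is a positive squarefree divisor of $\Delta$ with $\gcd(g,c)=1$, and $m$ is a positive integer with $\gcd(m,\Delta)=1$. Let $r_g$ be the residue class $r_g\equiv -d\bar c \pmod g$, where $\bar c$ is the inverse of $c$ modulo $g$. Then the roots $r$ modulo $mg$ of $(ar+b)(cr+d)\equiv 0\pmod{mg}$ are in one-to-one correspondence with the factorizations $m=k\ell$ into positive integers with $\gcd(k,\ell)=1$, $\gcd(k,a)=1$ and $\gcd(\ell,c)=1$; the root corresponding to $(k,\ell)$ is the unique solution modulo $mg$ of the system $$ar+b\equiv 0 \pmod k,\qquad cr+d\equiv 0\pmod \ell,\qquad r\equiv r_g \pmod g.$$ -}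

module Defs where

open import Data.Nat as ℕ using (ℕ)
open import Data.Nat.Primality using (Prime)
import Data.Nat.Divisibility as ℕD
open import Data.Integer using (ℤ; +_; _+_; _-_; _*_; -_; 1ℤ)
open import Data.Integer.Divisibility using (_∣_)
open import Data.Fin using (Fin; toℕ)
open import Data.Product using (_×_)
open import Relation.Binary.PropositionalEquality using (_≡_)
open import Relation.Nullary using (¬_)

infix 4 _≡_[mod_]
_≡_[mod_] : ℤ → ℤ → ℕ → Set
x ≡ y [mod n ] = (+ n) ∣ (x - y)

SquareFree : ℕ → Set
SquareFree n = ∀ (p : ℕ) → Prime p → ¬ (ℕD._∣_ (p ℕ.* p) n)

-- the residue class r mod N, N = m g, represented by 0 ≤ r < N, viewed as integer
toℤ : ∀ {N : ℕ} → Fin N → ℤ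
toℤ r = + toℕ r

-- the system in the lemma, for r_g := -d * cbar with cbar the inverse of c mod g
System : (a b c d cbar : ℤ) (g k ℓ : ℕ) → ℤ → Set
System a b c d cbar g k ℓ r =
  (a * r + b) ≡ + 0 [mod k ] × (c * r + d) ≡ + 0 [mod ℓ ] × r ≡ (- d) * cbar [mod g ]

{-# OPTIONS --safe #-}
-- Write A x = a x + b and C x = c x + d, so that a · C x − c · A x = Δ. Hence a common
-- divisor of A r and C r divides Δ and is prime to m, and a common divisor of A r and a
-- divides b. For a root r modulo m g this forces k = gcd (m, A r) and ℓ = m / k: they are
-- coprime, k ⊥ a, ℓ ⊥ c, and ℓ ∣ C r because m ∣ A r · C r. On the g side every divisor
-- of gcd (g, A r) is prime to a and divides a · C r = Δ + c · A r, hence divides C r; as g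
-- is squarefree, g / gcd (g, A r) is prime to gcd (g, A r), so g ∣ C r, i.e. r ≡ −d c̄.
-- Conversely, for an admissible (k, ℓ) the system is solvable by the Chinese remainder
-- theorem (k, ℓ and g pairwise coprime, k ⊥ a, ℓ ⊥ c), uniquely modulo k ℓ g = m g.
module Submission where

open import Defs
open import Data.Nat as ℕ using (ℕ)
open import Data.Integer using (ℤ; +_; _+_; _-_; _*_; -_; 1ℤ; 0ℤ)
open import Data.Integer.Divisibility using (_∣_)
open import Data.Integer.GCD using (gcd)
open import Data.Fin using (Fin)
open import Data.Product using (_×_; Σ; ∃; ∃-syntax; _,_)
open import Function.Bundles using (_⇔_)
open import Relation.Binary.PropositionalEquality using (_≡_)
open import Relation.Nullary using (¬_)

open import Data.Empty using (⊥-elim)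
open import Data.Fin as Fin using (toℕ; fromℕ<)
import Data.Fin.Properties as Fin
open import Data.Integer as ℤ using (∣_∣; -[1+_])
open import Data.Integer.DivMod using (_%ℕ_; _/ℕ_; n%ℕd<d; a≡a%ℕn+[a/ℕn]*n)
import Data.Integer.Divisibility.Signed as Signed
import Data.Integer.Properties as ℤ
open import Data.Integer.Tactic.RingSolver using (solve-∀)
open import Data.Nat as ℕ using (zero; suc; NonZero)
open import Data.Nat.Coprimality as Coprime using (Coprime; coprime-divisor; coprime-/gcd)
import Data.Nat.Divisibility as ℕ
open import Data.Nat.DivMod using (_/_; m/n*n≡m; m*[n/m]≡n)
import Data.Nat.GCD as ℕ
open import Data.Nat.GCD using (module Bézout)
open import Data.Nat.LCM using (lcm; lcm-least; gcd*lcm)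
open import Data.Nat.ListAction using (product)
open import Data.Nat.Primality using (Prime; prime[2])
open import Data.Nat.Primality.Factorisation using (factorise)
import Data.Nat.Properties as ℕ
open import Data.List using ([]; _∷_)
open import Data.List.Relation.Unary.All using (_∷_)
open import Data.Product using (proj₁)
open import Data.Sum using (inj₁)
open import Function using (_∘_; it)
open import Function.Bundles using (mk⇔; Equivalence)
open import Relation.Binary.PropositionalEquality
  using (refl; sym; trans; cong; cong₂; subst; subst₂; module ≡-Reasoning)
open import Relation.Nullary using (yes; no)

gcd-nonZeroˡ : ∀ m n .{{_ : NonZero m}} → NonZero (ℕ.gcd m n)
gcd-nonZeroˡ m@(suc _) n = ℕ.≢-nonZero (ℕ.gcd[m,n]≢0 m n (inj₁ λ ()))

coprime⇒*∣ : ∀ {m n o} → Coprime m n → m ℕ.∣ o → n ℕ.∣ o → m ℕ.* n ℕ.∣ o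
coprime⇒*∣ {m} {n} {o} m⊥n m∣o n∣o = subst (ℕ._∣ o) lcm≡* (lcm-least m∣o n∣o)
  where
  open ≡-Reasoning
  lcm≡* : lcm m n ≡ m ℕ.* n
  lcm≡* = begin
    lcm m n              ≡⟨ ℕ.*-identityˡ (lcm m n) ⟨
    1 ℕ.* lcm m n        ≡⟨ cong (ℕ._* lcm m n) (Coprime.coprime⇒gcd≡1 m⊥n) ⟨
    ℕ.gcd m n ℕ.* lcm m n ≡⟨ gcd*lcm m n ⟩
    m ℕ.* n              ∎

∣*⇒/gcd∣ : ∀ n x {y} .{{_ : NonZero (ℕ.gcd n x)}} → n ℕ.∣ x ℕ.* y → n / ℕ.gcd n x ℕ.∣ y
∣*⇒/gcd∣ n x {y} n∣xy =
  coprime-divisor (coprime-/gcd n x) (ℕ.*-cancelʳ-∣ h (subst₂ ℕ._∣_ n≡ xy≡ n∣xy))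
  where
  h : ℕ
  h = ℕ.gcd n x
  open ≡-Reasoning
  n≡ : n ≡ n / h ℕ.* h
  n≡ = sym (m/n*n≡m (ℕ.gcd[m,n]∣m n x))
  xy≡ : x ℕ.* y ≡ x / h ℕ.* y ℕ.* h
  xy≡ = begin
    x ℕ.* y               ≡⟨ cong (ℕ._* y) (m/n*n≡m (ℕ.gcd[m,n]∣n n x)) ⟨
    x / h ℕ.* h ℕ.* y     ≡⟨ ℕ.*-assoc (x / h) h y ⟩
    x / h ℕ.* (h ℕ.* y)   ≡⟨ cong (x / h ℕ.*_) (ℕ.*-comm h y) ⟩
    x / h ℕ.* (y ℕ.* h)   ≡⟨ ℕ.*-assoc (x / h) y h ⟨
    x / h ℕ.* y ℕ.* h     ∎


prime-divisor : ∀ e → .{{_ : NonZero e}} → ¬ (e ≡ 1) → ∃[ p ] Prime p × p ℕ.∣ e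
prime-divisor e e≢1 with factorise e
... | record { factors = [] ; isFactorisation = e≡1 } = ⊥-elim (e≢1 e≡1)
... | record { factors = p ∷ ps ; isFactorisation = e≡Π ; factorsPrime = p-prime ∷ _ } =
  p , p-prime , subst (p ℕ.∣_) (sym e≡Π) (ℕ.m∣m*n (product ps))

squareFree-square∣⇒≡1 : ∀ {n e} → SquareFree n → e ℕ.* e ℕ.∣ n → e ≡ 1
squareFree-square∣⇒≡1 {e = zero} sf 0∣n =
  ⊥-elim (sf 2 prime[2] (subst (4 ℕ.∣_) (sym (ℕ.0∣⇒≡0 0∣n)) (4 ℕ.∣0)))
squareFree-square∣⇒≡1 {e = e@(suc _)} sf e²∣n with e ℕ.≟ 1
... | yes e≡1 = e≡1
... | no e≢1 with prime-divisor e e≢1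
...   | p , p-prime , p∣e = ⊥-elim (sf p p-prime (ℕ.∣-trans (ℕ.*-pres-∣ p∣e p∣e) e²∣n))

squareFree-∣*⇒∣ : ∀ n x {y} .{{_ : NonZero n}} →
                  SquareFree n → n ℕ.∣ x ℕ.* y → ℕ.gcd n x ℕ.∣ y → n ℕ.∣ y
squareFree-∣*⇒∣ n x sf n∣xy h∣y = subst (ℕ._∣ _) (m/n*n≡m (ℕ.gcd[m,n]∣m n x))
  (coprime⇒*∣ q⊥h (∣*⇒/gcd∣ n x n∣xy) h∣y)
  where
  instance _ = gcd-nonZeroˡ n x
  q⊥h : Coprime (n / ℕ.gcd n x) (ℕ.gcd n x)
  q⊥h (e∣q , e∣h) = squareFree-square∣⇒≡1 sf
    (ℕ.∣-trans (ℕ.*-pres-∣ e∣q e∣h) (ℕ.∣-reflexive (m/n*n≡m (ℕ.gcd[m,n]∣m n x))))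

∣∧<⇒≡0 : ∀ {m n} → n ℕ.∣ m → m ℕ.< n → m ≡ 0
∣∧<⇒≡0 {zero}  _   _   = refl
∣∧<⇒≡0 {suc _} n∣m m<n = ⊥-elim (ℕ.>⇒∤ m<n n∣m)

gcd≡1ℤ⇒coprime : ∀ i j → gcd i j ≡ 1ℤ → Coprime ∣ i ∣ ∣ j ∣
gcd≡1ℤ⇒coprime _ _ = Coprime.gcd≡1⇒coprime ∘ ℤ.+-injective

coprime⇒gcd≡1ℤ : ∀ i j → Coprime ∣ i ∣ ∣ j ∣ → gcd i j ≡ 1ℤ
coprime⇒gcd≡1ℤ _ _ = cong +_ ∘ Coprime.coprime⇒gcd≡1

+n∣w*+n : ∀ w n → + n ∣ w * + n
+n∣w*+n w n = subst (n ℕ.∣_) (sym (ℤ.abs-* w (+ n))) (ℕ.n∣m*n ∣ w ∣)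

∣i∣-as-unit-multiple : ∀ i → ∃[ s ] s * i ≡ + ∣ i ∣
∣i∣-as-unit-multiple (+ n)    = 1ℤ , ℤ.*-identityˡ (+ n)
∣i∣-as-unit-multiple -[1+ n ] = - 1ℤ , ℤ.-1*i≡-i -[1+ n ]

ℕ-Bézout⇒ℤ : ∀ {x y m n} → 1 ℕ.+ y ℕ.* n ≡ x ℕ.* m → + x * + m - + y * + n ≡ 1ℤ
ℕ-Bézout⇒ℤ {x} {y} {m} {n} eq = begin
  + x * + m - + y * + n                 ≡⟨ cong₂ _-_ (ℤ.pos-* x m) (ℤ.pos-* y n) ⟨
  + (x ℕ.* m) - + (y ℕ.* n)             ≡⟨ cong (λ w → + w - + (y ℕ.* n)) eq ⟨
  + (1 ℕ.+ y ℕ.* n) - + (y ℕ.* n)       ≡⟨ cong (_- + (y ℕ.* n)) (ℤ.pos-+ 1 (y ℕ.* n)) ⟩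
  1ℤ + + (y ℕ.* n) - + (y ℕ.* n)        ≡⟨ cancel (+ (y ℕ.* n)) ⟩
  1ℤ                                    ∎
  where
  open ≡-Reasoning
  cancel : ∀ w → 1ℤ + w - w ≡ 1ℤ
  cancel = solve-∀

coprime⇒Bézout : ∀ i j → Coprime ∣ i ∣ ∣ j ∣ → ∃[ u ] ∃[ v ] u * i + v * j ≡ 1ℤ
coprime⇒Bézout i j i⊥j with Coprime.coprime-Bézout i⊥j | ∣i∣-as-unit-multiple i | ∣i∣-as-unit-multiple j
... | Bézout.+- x y eq | s , si≡∣i∣ | t , tj≡∣j∣ = + x * s , - + y * t , (begin
  + x * s * i + - + y * t * j        ≡⟨ regroup (+ x) s i (+ y) t j ⟩
  + x * (s * i) - + y * (t * j)      ≡⟨ cong₂ (λ p q → + x * p - + y * q) si≡∣i∣ tj≡∣j∣ ⟩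
  + x * + ∣ i ∣ - + y * + ∣ j ∣      ≡⟨ ℕ-Bézout⇒ℤ {x} {y} {∣ i ∣} {∣ j ∣} eq ⟩
  1ℤ                                 ∎)
  where
  open ≡-Reasoning
  regroup : ∀ x s i y t j → x * s * i + - y * t * j ≡ x * (s * i) - y * (t * j)
  regroup = solve-∀
... | Bézout.-+ x y eq | s , si≡∣i∣ | t , tj≡∣j∣ = - + x * s , + y * t , (begin
  - + x * s * i + + y * t * j        ≡⟨ regroup (+ x) s i (+ y) t j ⟩
  + y * (t * j) - + x * (s * i)      ≡⟨ cong₂ (λ p q → + y * q - + x * p) si≡∣i∣ tj≡∣j∣ ⟩
  + y * + ∣ j ∣ - + x * + ∣ i ∣      ≡⟨ ℕ-Bézout⇒ℤ {y} {x} {∣ j ∣} {∣ i ∣} eq ⟩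
  1ℤ                                 ∎)
  where
  open ≡-Reasoning
  regroup : ∀ x s i y t j → - x * s * i + y * t * j ≡ y * (t * j) - x * (s * i)
  regroup = solve-∀

module _ {n : ℕ} where

  ≡0[mod]⇒∣ : ∀ x → x ≡ 0ℤ [mod n ] → + n ∣ x
  ≡0[mod]⇒∣ x = subst (n ℕ.∣_) (cong ∣_∣ (ℤ.+-identityʳ x))

  ∣⇒≡0[mod] : ∀ x → + n ∣ x → x ≡ 0ℤ [mod n ]
  ∣⇒≡0[mod] x = subst (n ℕ.∣_) (cong ∣_∣ (sym (ℤ.+-identityʳ x)))

  ≡[mod]-sym : ∀ x y → x ≡ y [mod n ] → y ≡ x [mod n ]
  ≡[mod]-sym x y = subst (n ℕ.∣_) (ℤ.∣i-j∣≡∣j-i∣ x y)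

  ≡[mod]-trans : ∀ x y z → x ≡ y [mod n ] → y ≡ z [mod n ] → x ≡ z [mod n ]
  ≡[mod]-trans x y z x≡y y≡z = Signed.∣⇒∣ᵤ (subst (+ n Signed.∣_) (telescope x y z)
    (Signed.∣m∣n⇒∣m+n {+ n} {x - y} (Signed.∣ᵤ⇒∣ x≡y) (Signed.∣ᵤ⇒∣ y≡z)))
    where
    telescope : ∀ x y z → x - y + (y - z) ≡ x - z
    telescope = solve-∀

∣affine-difference∣ : ∀ a b x y → ∣ a * x + b - (a * y + b) ∣ ≡ ∣ a ∣ ℕ.* ∣ x - y ∣
∣affine-difference∣ a b x y = trans (cong ∣_∣ (difference a b x y)) (ℤ.abs-* a (x - y))
  where
  difference : ∀ a b x y → a * x + b - (a * y + b) ≡ a * (x - y)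
  difference = solve-∀

module _ {n : ℕ} (a b : ℤ) where

  ≡[mod]-affine : ∀ x y → x ≡ y [mod n ] → a * x + b ≡ a * y + b [mod n ]
  ≡[mod]-affine x y x≡y = subst (n ℕ.∣_) (sym (∣affine-difference∣ a b x y)) (ℕ.∣n⇒∣m*n ∣ a ∣ x≡y)

  ≡[mod]-affine-cancel : ∀ x y → Coprime n ∣ a ∣ → a * x + b ≡ a * y + b [mod n ] → x ≡ y [mod n ]
  ≡[mod]-affine-cancel x y n⊥a = coprime-divisor n⊥a ∘ subst (n ℕ.∣_) (∣affine-difference∣ a b x y)

  affine-root-resp : ∀ x y → x ≡ y [mod n ] → a * y + b ≡ 0ℤ [mod n ] → a * x + b ≡ 0ℤ [mod n ]
  affine-root-resp x y x≡y = ≡[mod]-trans (a * x + b) (a * y + b) 0ℤ (≡[mod]-affine x y x≡y)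

coprime⇒affine-root : ∀ {n} a b → Coprime n ∣ a ∣ → ∃[ x ] a * x + b ≡ 0ℤ [mod n ]
coprime⇒affine-root {n} a b n⊥a with coprime⇒Bézout (+ n) a n⊥a
... | u , v , un+va≡1 =
  - b * v , ∣⇒≡0[mod] (a * (- b * v) + b) (subst (+ n ∣_) (sym root) (+n∣w*+n (b * u) n))
  where
  open ≡-Reasoning
  expand : ∀ a b u v n → a * (- b * v) + b * (u * n + v * a) ≡ b * u * n
  expand = solve-∀
  root : a * (- b * v) + b ≡ b * u * + n
  root = begin
    a * (- b * v) + b                       ≡⟨ cong (λ w → a * (- b * v) + w) (ℤ.*-identityʳ b) ⟨
    a * (- b * v) + b * 1ℤ                  ≡⟨ cong (λ w → a * (- b * v) + b * w) un+va≡1 ⟨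
    a * (- b * v) + b * (u * + n + v * a)   ≡⟨ expand a b u v (+ n) ⟩
    b * u * + n                             ∎

module _ {n : ℕ} (c c̄ d : ℤ) (cc̄≡1 : c * c̄ ≡ 1ℤ [mod n ]) where

  inverse⇒affine-root : c * (- d * c̄) + d ≡ 0ℤ [mod n ]
  inverse⇒affine-root = subst (n ℕ.∣_) (sym ∣root∣) (ℕ.∣n⇒∣m*n ∣ - d ∣ cc̄≡1)
    where
    factor : ∀ c c̄ d → c * (- d * c̄) + d - 0ℤ ≡ - d * (c * c̄ - 1ℤ)
    factor = solve-∀
    ∣root∣ : ∣ c * (- d * c̄) + d - 0ℤ ∣ ≡ ∣ - d ∣ ℕ.* ∣ c * c̄ - 1ℤ ∣
    ∣root∣ = trans (cong ∣_∣ (factor c c̄ d)) (ℤ.abs-* (- d) (c * c̄ - 1ℤ))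

  affine-root⇔ : ∀ x → Coprime n ∣ c ∣ → c * x + d ≡ 0ℤ [mod n ] ⇔ x ≡ - d * c̄ [mod n ]
  affine-root⇔ x n⊥c = mk⇔
    (λ root → ≡[mod]-affine-cancel c d x t n⊥c
      (≡[mod]-trans (c * x + d) 0ℤ (c * t + d) root (≡[mod]-sym (c * t + d) 0ℤ inverse⇒affine-root)))
    (λ x≡t → affine-root-resp c d x t x≡t inverse⇒affine-root)
    where
    t : ℤ
    t = - d * c̄

crt : ∀ {m n} → Coprime m n → ∀ x y → ∃[ z ] z ≡ x [mod m ] × z ≡ y [mod n ]
crt {m} {n} m⊥n x y with coprime⇒Bézout (+ m) (+ n) m⊥n
... | u , v , um+vn≡1 = z ,
  subst (m ℕ.∣_) (cong ∣_∣ (sym z-x)) (+n∣w*+n ((y - x) * u) m) ,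
  subst (n ℕ.∣_) (cong ∣_∣ (sym z-y)) (+n∣w*+n ((x - y) * v) n)
  where
  open ≡-Reasoning
  z : ℤ
  z = x * (v * + n) + y * (u * + m)
  weightˡ : ∀ x y u v m n → x * (v * n) + y * (u * m) - x * (u * m + v * n) ≡ (y - x) * u * m
  weightˡ = solve-∀
  weightʳ : ∀ x y u v m n → x * (v * n) + y * (u * m) - y * (u * m + v * n) ≡ (x - y) * v * n
  weightʳ = solve-∀
  z-x : z - x ≡ (y - x) * u * + m
  z-x = begin
    z - x                               ≡⟨ cong (λ e → z - e) (ℤ.*-identityʳ x) ⟨
    z - x * 1ℤ                          ≡⟨ cong (λ e → z - x * e) um+vn≡1 ⟨
    z - x * (u * + m + v * + n)         ≡⟨ weightˡ x y u v (+ m) (+ n) ⟩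
    (y - x) * u * + m                   ∎
  z-y : z - y ≡ (x - y) * v * + n
  z-y = begin
    z - y                               ≡⟨ cong (λ e → z - e) (ℤ.*-identityʳ y) ⟨
    z - y * 1ℤ                          ≡⟨ cong (λ e → z - y * e) um+vn≡1 ⟨
    z - y * (u * + m + v * + n)         ≡⟨ weightʳ x y u v (+ m) (+ n) ⟩
    (x - y) * v * + n                   ∎

residue : ∀ N .{{_ : NonZero N}} x → ∃[ r ] x ≡ toℤ {N} r [mod N ]
residue N x = fromℕ< (n%ℕd<d x N) , subst (N ℕ.∣_) (cong ∣_∣ (sym x-r≡)) (+n∣w*+n (x /ℕ N) N)
  where
  open ≡-Reasoning
  R : ℤ
  R = + (x %ℕ N)
  cancel : ∀ r q → r + q - r ≡ q
  cancel = solve-∀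
  x-r≡ : x - toℤ (fromℕ< (n%ℕd<d x N)) ≡ (x /ℕ N) * + N
  x-r≡ = begin
    x - toℤ (fromℕ< (n%ℕd<d x N))     ≡⟨ cong (λ w → x - + w) (Fin.toℕ-fromℕ< (n%ℕd<d x N)) ⟩
    x - R                             ≡⟨ cong (_- R) (a≡a%ℕn+[a/ℕn]*n x N) ⟩
    R + (x /ℕ N) * + N - R            ≡⟨ cancel R ((x /ℕ N) * + N) ⟩
    (x /ℕ N) * + N                    ∎

≡[mod]⇒toℤ-injective : ∀ {N} {r r′ : Fin N} → toℤ r ≡ toℤ r′ [mod N ] → r ≡ r′
≡[mod]⇒toℤ-injective {N} {r} {r′} r≡r′ =
  Fin.toℕ-injective (ℤ.+-injective (ℤ.i-j≡0⇒i≡j (toℤ r) (toℤ r′) (ℤ.∣i∣≡0⇒i≡0 ∣r-r′∣≡0)))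
  where
  ∣r-r′∣≤ : ∣ toℤ r - toℤ r′ ∣ ℕ.≤ toℕ r ℕ.⊔ toℕ r′
  ∣r-r′∣≤ = subst (ℕ._≤ toℕ r ℕ.⊔ toℕ r′) (cong ∣_∣ (sym (ℤ.m-n≡m⊖n (toℕ r) (toℕ r′))))
                  (ℤ.∣m⊝n∣≤m⊔n (toℕ r) (toℕ r′))
  ∣r-r′∣≡0 : ∣ toℤ r - toℤ r′ ∣ ≡ 0
  ∣r-r′∣≡0 = ∣∧<⇒≡0 r≡r′ (ℕ.≤-<-trans ∣r-r′∣≤ (ℕ.⊔-lub (Fin.toℕ<n r) (Fin.toℕ<n r′)))

module _ {e : ℕ} (a b x : ℤ) where

  ∣affine∧∣coeff⇒∣const : + e ∣ a * x + b → + e ∣ a → + e ∣ b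
  ∣affine∧∣coeff⇒∣const e∣A e∣a = Signed.∣⇒∣ᵤ (subst (+ e Signed.∣_) (cancel a b x)
    (Signed.∣m∣n⇒∣m-n (Signed.∣ᵤ⇒∣ {+ e} {a * x + b} e∣A)
                       (Signed.∣m⇒∣m*n x (Signed.∣ᵤ⇒∣ {+ e} {a} e∣a))))
    where
    cancel : ∀ a b x → a * x + b - a * x ≡ b
    cancel = solve-∀

  module _ (c d : ℤ) where

    ∣affine∧∣affine⇒∣det : + e ∣ a * x + b → + e ∣ c * x + d → + e ∣ a * d - b * c
    ∣affine∧∣affine⇒∣det e∣A e∣C = Signed.∣⇒∣ᵤ (subst (+ e Signed.∣_) (eliminate a b c d x)
      (Signed.∣m∣n⇒∣m-n (Signed.∣n⇒∣m*n a (Signed.∣ᵤ⇒∣ {+ e} {c * x + d} e∣C))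
                         (Signed.∣n⇒∣m*n c (Signed.∣ᵤ⇒∣ {+ e} {a * x + b} e∣A))))
      where
      eliminate : ∀ a b c d x → a * (c * x + d) - c * (a * x + b) ≡ a * d - b * c
      eliminate = solve-∀

    ∣det∧∣affine⇒∣coeff*affine : + e ∣ a * d - b * c → + e ∣ a * x + b → + e ∣ a * (c * x + d)
    ∣det∧∣affine⇒∣coeff*affine e∣Δ e∣A = Signed.∣⇒∣ᵤ (subst (+ e Signed.∣_) (recombine a b c d x)
      (Signed.∣m∣n⇒∣m+n (Signed.∣ᵤ⇒∣ {+ e} {a * d - b * c} e∣Δ)
                         (Signed.∣n⇒∣m*n c (Signed.∣ᵤ⇒∣ {+ e} {a * x + b} e∣A))))
      where
      recombine : ∀ a b c d x → a * d - b * c + c * (a * x + b) ≡ a * (c * x + d)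
      recombine = solve-∀

module Roots
  (a b c d : ℤ) (gcd[a,b]≡1 : gcd a b ≡ 1ℤ) (gcd[c,d]≡1 : gcd c d ≡ 1ℤ)
  (g : ℕ) .{{_ : NonZero g}} (g-squareFree : SquareFree g)
  (g∣Δ : + g ∣ a * d - b * c) (gcd[g,c]≡1 : gcd (+ g) c ≡ 1ℤ)
  (m : ℕ) .{{_ : NonZero m}} (gcd[m,Δ]≡1 : gcd (+ m) (a * d - b * c) ≡ 1ℤ)
  (c̄ : ℤ) (cc̄≡1 : c * c̄ ≡ 1ℤ [mod g ])
  where

  A C : ℤ → ℤ
  A x = a * x + b
  C x = c * x + d

  t : ℤ
  t = - d * c̄

  N : ℕ
  N = m ℕ.* g

  Admissible : ℕ → ℕ → Set
  Admissible k ℓ = (k ℕ.* ℓ ≡ m) × gcd (+ k) (+ ℓ) ≡ 1ℤ × gcd (+ k) a ≡ 1ℤ × gcd (+ ℓ) c ≡ 1ℤ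

  Solves : ℕ → ℕ → ℤ → Set
  Solves k ℓ x = System a b c d c̄ g k ℓ x

  IsRoot : ℤ → Set
  IsRoot x = A x * C x ≡ 0ℤ [mod N ]

  m⊥Δ : Coprime m ∣ a * d - b * c ∣
  m⊥Δ = gcd≡1ℤ⇒coprime (+ m) (a * d - b * c) gcd[m,Δ]≡1

  m⊥g : Coprime m g
  m⊥g (e∣m , e∣g) = m⊥Δ (e∣m , ℕ.∣-trans e∣g g∣Δ)

  g⊥c : Coprime g ∣ c ∣
  g⊥c = gcd≡1ℤ⇒coprime (+ g) c gcd[g,c]≡1

  ∣m∧∣A∧∣C⇒≡1 : ∀ {e} x → e ℕ.∣ m → + e ∣ A x → + e ∣ C x → e ≡ 1
  ∣m∧∣A∧∣C⇒≡1 x e∣m e∣A e∣C = m⊥Δ (e∣m , ∣affine∧∣affine⇒∣det a b x c d e∣A e∣C)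

  ∣A∧∣a⇒≡1 : ∀ {e} x → + e ∣ A x → e ℕ.∣ ∣ a ∣ → e ≡ 1
  ∣A∧∣a⇒≡1 x e∣A e∣a = gcd≡1ℤ⇒coprime a b gcd[a,b]≡1 (e∣a , ∣affine∧∣coeff⇒∣const a b x e∣A e∣a)

  ∣C∧∣c⇒≡1 : ∀ {e} x → + e ∣ C x → e ℕ.∣ ∣ c ∣ → e ≡ 1
  ∣C∧∣c⇒≡1 x e∣C e∣c = gcd≡1ℤ⇒coprime c d gcd[c,d]≡1 (e∣c , ∣affine∧∣coeff⇒∣const c d x e∣C e∣c)

  C-root⇔≡t : ∀ x → C x ≡ 0ℤ [mod g ] ⇔ x ≡ t [mod g ]
  C-root⇔≡t x = affine-root⇔ c c̄ d cc̄≡1 x g⊥c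

  g∣A*C⇒g∣C : ∀ x → g ℕ.∣ ∣ A x ∣ ℕ.* ∣ C x ∣ → g ℕ.∣ ∣ C x ∣
  g∣A*C⇒g∣C x g∣AC = squareFree-∣*⇒∣ g ∣ A x ∣ g-squareFree g∣AC h∣C
    where
    h : ℕ
    h = ℕ.gcd g ∣ A x ∣
    h∣A : h ℕ.∣ ∣ A x ∣
    h∣A = ℕ.gcd[m,n]∣n g ∣ A x ∣
    h∣aC : + h ∣ a * C x
    h∣aC = ∣det∧∣affine⇒∣coeff*affine a b x c d (ℕ.∣-trans (ℕ.gcd[m,n]∣m g ∣ A x ∣) g∣Δ) h∣A
    h∣C : h ℕ.∣ ∣ C x ∣
    h∣C = coprime-divisor (λ (e∣h , e∣a) → ∣A∧∣a⇒≡1 x (ℕ.∣-trans e∣h h∣A) e∣a)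
                          (subst (h ℕ.∣_) (ℤ.abs-* a (C x)) h∣aC)

  -- x ≡ y [mod n] unfolds to n ∣ ∣ x - y ∣ in ℕ, so ℕ.∣-trans passes it to divisors of n.
  system-resp : ∀ {k ℓ} x y → k ℕ.* ℓ ≡ m → x ≡ y [mod N ] → Solves k ℓ y → Solves k ℓ x
  system-resp {k} {ℓ} x y kℓ≡m x≡y (A-root , C-root , y≡t) =
    affine-root-resp a b x y (ℕ.∣-trans k∣N x≡y) A-root ,
    affine-root-resp c d x y (ℕ.∣-trans ℓ∣N x≡y) C-root ,
    ≡[mod]-trans x y t (ℕ.∣-trans (ℕ.n∣m*n m) x≡y) y≡t
    where
    k∣N : k ℕ.∣ N
    k∣N = ℕ.∣-trans (ℕ.divides ℓ (trans (sym kℓ≡m) (ℕ.*-comm k ℓ))) (ℕ.m∣m*n g)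
    ℓ∣N : ℓ ℕ.∣ N
    ℓ∣N = ℕ.∣-trans (ℕ.divides k (sym kℓ≡m)) (ℕ.m∣m*n g)

  system-solvable : ∀ {k ℓ} → Admissible k ℓ → ∃[ x ] Solves k ℓ x
  system-solvable {k} {ℓ} (kℓ≡m , gcd[k,ℓ]≡1 , gcd[k,a]≡1 , gcd[ℓ,c]≡1) =
    let x₁ , A-root = coprime⇒affine-root a b (gcd≡1ℤ⇒coprime (+ k) a gcd[k,a]≡1)
        x₂ , C-root = coprime⇒affine-root c d (gcd≡1ℤ⇒coprime (+ ℓ) c gcd[ℓ,c]≡1)
        y , y≡x₁ , y≡x₂ = crt (gcd≡1ℤ⇒coprime (+ k) (+ ℓ) gcd[k,ℓ]≡1) x₁ x₂
        z , z≡y , z≡t = crt (subst (λ n → Coprime n g) (sym kℓ≡m) m⊥g) y t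
    in z ,
       affine-root-resp a b z x₁ (≡[mod]-trans z y x₁ (ℕ.∣-trans (ℕ.m∣m*n ℓ) z≡y) y≡x₁) A-root ,
       affine-root-resp c d z x₂ (≡[mod]-trans z y x₂ (ℕ.∣-trans (ℕ.n∣m*n k) z≡y) y≡x₂) C-root ,
       z≡t

  system-unique : ∀ {k ℓ} x y → Admissible k ℓ → Solves k ℓ x → Solves k ℓ y → x ≡ y [mod N ]
  system-unique {k} {ℓ} x y (kℓ≡m , gcd[k,ℓ]≡1 , gcd[k,a]≡1 , gcd[ℓ,c]≡1)
                (A[x]-root , C[x]-root , x≡t) (A[y]-root , C[y]-root , y≡t) =
    coprime⇒*∣ m⊥g (subst (ℕ._∣ ∣ x - y ∣) kℓ≡m (coprime⇒*∣ k⊥ℓ k∣x-y ℓ∣x-y))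
                   (≡[mod]-trans x t y x≡t (≡[mod]-sym y t y≡t))
    where
    k⊥ℓ : Coprime k ℓ
    k⊥ℓ = gcd≡1ℤ⇒coprime (+ k) (+ ℓ) gcd[k,ℓ]≡1
    k∣x-y : x ≡ y [mod k ]
    k∣x-y = ≡[mod]-affine-cancel a b x y (gcd≡1ℤ⇒coprime (+ k) a gcd[k,a]≡1)
      (≡[mod]-trans (A x) 0ℤ (A y) A[x]-root (≡[mod]-sym (A y) 0ℤ A[y]-root))
    ℓ∣x-y : x ≡ y [mod ℓ ]
    ℓ∣x-y = ≡[mod]-affine-cancel c d x y (gcd≡1ℤ⇒coprime (+ ℓ) c gcd[ℓ,c]≡1)
      (≡[mod]-trans (C x) 0ℤ (C y) C[x]-root (≡[mod]-sym (C y) 0ℤ C[y]-root))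

  solution : ∀ {k ℓ} → Admissible k ℓ →
             Σ (Fin N) λ r → Solves k ℓ (toℤ r) × (∀ r′ → Solves k ℓ (toℤ r′) → r′ ≡ r)
  solution adm =
    let x , x-solves = system-solvable adm
        r , x≡r = residue N {{ℕ.m*n≢0 m g}} x
        r-solves = system-resp (toℤ r) x (proj₁ adm) (≡[mod]-sym x (toℤ r) x≡r) x-solves
    in r , r-solves , λ r′ r′-solves →
         ≡[mod]⇒toℤ-injective (system-unique (toℤ r′) (toℤ r) adm r′-solves r-solves)

  solves⇒root : ∀ {k ℓ} x → k ℕ.* ℓ ≡ m → Solves k ℓ x → IsRoot x
  solves⇒root x kℓ≡m (A-root , C-root , x≡t) =
    ∣⇒≡0[mod] (A x * C x)
      (subst (N ℕ.∣_) (sym (ℤ.abs-* (A x) (C x))) (coprime⇒*∣ m⊥g m∣AC g∣AC))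
    where
    m∣AC : m ℕ.∣ ∣ A x ∣ ℕ.* ∣ C x ∣
    m∣AC = subst (ℕ._∣ ∣ A x ∣ ℕ.* ∣ C x ∣) kℓ≡m
                 (ℕ.*-pres-∣ (≡0[mod]⇒∣ (A x) A-root) (≡0[mod]⇒∣ (C x) C-root))
    g∣AC : g ℕ.∣ ∣ A x ∣ ℕ.* ∣ C x ∣
    g∣AC = ℕ.∣n⇒∣m*n ∣ A x ∣ (≡0[mod]⇒∣ (C x) (Equivalence.from (C-root⇔≡t x) x≡t))

  root⇒solves : ∀ x → IsRoot x → ∃[ k ] ∃[ ℓ ] Admissible k ℓ × Solves k ℓ x
  root⇒solves x root =
    k , ℓ ,
    (kℓ≡m , coprime⇒gcd≡1ℤ (+ k) (+ ℓ) k⊥ℓ ,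
            coprime⇒gcd≡1ℤ (+ k) a k⊥a , coprime⇒gcd≡1ℤ (+ ℓ) c ℓ⊥c) ,
    (∣⇒≡0[mod] (A x) k∣A , ∣⇒≡0[mod] (C x) ℓ∣C ,
     Equivalence.to (C-root⇔≡t x) (∣⇒≡0[mod] (C x) (g∣A*C⇒g∣C x (ℕ.∣-trans (ℕ.n∣m*n m) N∣AC))))
    where
    instance _ = gcd-nonZeroˡ m ∣ A x ∣
    N∣AC : N ℕ.∣ ∣ A x ∣ ℕ.* ∣ C x ∣
    N∣AC = subst (N ℕ.∣_) (ℤ.abs-* (A x) (C x)) (≡0[mod]⇒∣ (A x * C x) root)
    k ℓ : ℕ
    k = ℕ.gcd m ∣ A x ∣
    ℓ = m / k
    k∣m : k ℕ.∣ m
    k∣m = ℕ.gcd[m,n]∣m m ∣ A x ∣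
    k∣A : k ℕ.∣ ∣ A x ∣
    k∣A = ℕ.gcd[m,n]∣n m ∣ A x ∣
    kℓ≡m : k ℕ.* ℓ ≡ m
    kℓ≡m = m*[n/m]≡n k∣m
    ℓ∣C : ℓ ℕ.∣ ∣ C x ∣
    ℓ∣C = ∣*⇒/gcd∣ m ∣ A x ∣ (ℕ.∣-trans (ℕ.m∣m*n g) N∣AC)
    k⊥ℓ : Coprime k ℓ
    k⊥ℓ (e∣k , e∣ℓ) = ∣m∧∣A∧∣C⇒≡1 x (ℕ.∣-trans e∣k k∣m) (ℕ.∣-trans e∣k k∣A) (ℕ.∣-trans e∣ℓ ℓ∣C)
    k⊥a : Coprime k ∣ a ∣
    k⊥a (e∣k , e∣a) = ∣A∧∣a⇒≡1 x (ℕ.∣-trans e∣k k∣A) e∣a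
    ℓ⊥c : Coprime ℓ ∣ c ∣
    ℓ⊥c (e∣ℓ , e∣c) = ∣C∧∣c⇒≡1 x (ℕ.∣-trans e∣ℓ ℓ∣C) e∣c

  solves⇒k≡gcd[m,A] : ∀ {k ℓ} x → k ℕ.* ℓ ≡ m → Solves k ℓ x → k ≡ ℕ.gcd m ∣ A x ∣
  solves⇒k≡gcd[m,A] {k} {ℓ} x kℓ≡m (A-root , C-root , _) =
    ℕ.∣-antisym (ℕ.gcd-greatest k∣m k∣A) (coprime-divisor G⊥ℓ G∣kℓ)
    where
    G : ℕ
    G = ℕ.gcd m ∣ A x ∣
    k∣m : k ℕ.∣ m
    k∣m = ℕ.divides ℓ (trans (sym kℓ≡m) (ℕ.*-comm k ℓ))
    k∣A : k ℕ.∣ ∣ A x ∣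
    k∣A = ≡0[mod]⇒∣ (A x) A-root
    G∣kℓ : G ℕ.∣ ℓ ℕ.* k
    G∣kℓ = subst (G ℕ.∣_) (trans (sym kℓ≡m) (ℕ.*-comm k ℓ)) (ℕ.gcd[m,n]∣m m ∣ A x ∣)
    G⊥ℓ : Coprime G ℓ
    G⊥ℓ (e∣G , e∣ℓ) = ∣m∧∣A∧∣C⇒≡1 x (ℕ.∣-trans e∣G (ℕ.gcd[m,n]∣m m ∣ A x ∣))
      (ℕ.∣-trans e∣G (ℕ.gcd[m,n]∣n m ∣ A x ∣)) (ℕ.∣-trans e∣ℓ (≡0[mod]⇒∣ (C x) C-root))

  factorisation-unique : ∀ {k ℓ k′ ℓ′} x → k ℕ.* ℓ ≡ m → Solves k ℓ x →
                         k′ ℕ.* ℓ′ ≡ m → Solves k′ ℓ′ x → k ≡ k′ × ℓ ≡ ℓ′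
  factorisation-unique {k} {ℓ} {k′} {ℓ′} x kℓ≡m sol k′ℓ′≡m sol′ =
    k≡k′ , ℕ.*-cancelˡ-≡ ℓ ℓ′ k {{k≢0}} (trans kℓ≡m (sym kℓ′≡m))
    where
    k≡k′ : k ≡ k′
    k≡k′ = trans (solves⇒k≡gcd[m,A] x kℓ≡m sol) (sym (solves⇒k≡gcd[m,A] x k′ℓ′≡m sol′))
    kℓ′≡m : k ℕ.* ℓ′ ≡ m
    kℓ′≡m = subst (λ j → j ℕ.* ℓ′ ≡ m) (sym k≡k′) k′ℓ′≡m
    k≢0 : NonZero k
    k≢0 = ℕ.m*n≢0⇒m≢0 k {{subst NonZero (sym kℓ≡m) it}}

lemma3 : (a b c d : ℤ) → ¬ (a * c ≡ 0ℤ) → gcd a b ≡ 1ℤ → gcd c d ≡ 1ℤ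
  → ¬ (a * d - b * c ≡ 0ℤ)
  → (g : ℕ) → 0 ℕ.< g → SquareFree g → (+ g) ∣ (a * d - b * c) → gcd (+ g) c ≡ 1ℤ
  → (m : ℕ) → 0 ℕ.< m → gcd (+ m) (a * d - b * c) ≡ 1ℤ
  → (cbar : ℤ) → c * cbar ≡ 1ℤ [mod g ]
  → let Fact : ℕ → ℕ → Set
        Fact k ℓ = (k ℕ.* ℓ ≡ m) × gcd (+ k) (+ ℓ) ≡ 1ℤ × gcd (+ k) a ≡ 1ℤ × gcd (+ ℓ) c ≡ 1ℤ
        Sys : ℕ → ℕ → Fin (m ℕ.* g) → Set
        Sys k ℓ r = System a b c d cbar g k ℓ (toℤ r)
    in
    -- each admissible factorization determines a unique solution r mod mg of the system
    (∀ (k ℓ : ℕ) → Fact k ℓ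
       → Σ (Fin (m ℕ.* g)) λ r → Sys k ℓ r × (∀ (r′ : Fin (m ℕ.* g)) → Sys k ℓ r′ → r′ ≡ r))
    -- every r mod mg is a root iff it is the solution for some admissible factorization
    × (∀ (r : Fin (m ℕ.* g))
         → ((a * toℤ r + b) * (c * toℤ r + d) ≡ 0ℤ [mod m ℕ.* g ])
           ⇔ (∃[ k ] ∃[ ℓ ] (Fact k ℓ × Sys k ℓ r)))
    -- and that factorization is unique (the correspondence is one-to-one)
    × (∀ (r : Fin (m ℕ.* g)) (k ℓ k′ ℓ′ : ℕ) → Fact k ℓ → Sys k ℓ r → Fact k′ ℓ′ → Sys k′ ℓ′ r
         → (k ≡ k′ × ℓ ≡ ℓ′))
lemma3 a b c d _ gcd[a,b]≡1 gcd[c,d]≡1 _ g 0<g g-squareFree g∣Δ gcd[g,c]≡1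
       m 0<m gcd[m,Δ]≡1 c̄ cc̄≡1 =
  (λ k ℓ → solution) ,
  (λ r → mk⇔ (root⇒solves (toℤ r))
               (λ (k , ℓ , (kℓ≡m , _) , r-solves) → solves⇒root (toℤ r) kℓ≡m r-solves)) ,
  (λ r k ℓ k′ ℓ′ (kℓ≡m , _) r-solves (k′ℓ′≡m , _) →
     factorisation-unique (toℤ r) kℓ≡m r-solves k′ℓ′≡m)
  where
  open Roots a b c d gcd[a,b]≡1 gcd[c,d]≡1 g {{ℕ.>-nonZero 0<g}} g-squareFree g∣Δ gcd[g,c]≡1
             m {{ℕ.>-nonZero 0<m}} gcd[m,Δ]≡1 c̄ cc̄≡1
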